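{- Let $n\ge1$, $J\subseteq S_n^A$, and $x\in\mathfrak S_n$. Let $w\in\mathfrak S_n$ be written as $w=w's$ with $s\in S_n^A$ and $s\notin\mathrm{rw}(w')$. Then $$\widetilde P_{x,J}\bigl(\widetilde T_{w's}\cdot\widetilde T_x\bigr)=\widetilde P_{x,J}\Bigl(\widetilde T_{w'}\cdot\widetilde P_{x,J}\bigl(\widetilde T_s\cdot\widetilde T_x\bigr)\Bigr).$$
   Context: $H_n^A$ is the Hecke algebra of $\mathfrak S_n$ over $\mathbb{C}[q^{1/2},q^{ -1/2}]$ with modified generators $\widetilde T_{s_i}=q^{ -1/2}T_{s_i}$ ($s_i=(i,i+1)$) satisfying $\widetilde T_s^2=(q^{1/2}-q^{ -1/2})\widetilde T_s+1$ and the braid relations; $\widetilde T_w$ is the product along a reduced expression of $w$, and $\{\widetilde T_w\}$ is a basis. For $J\subseteq S_n^A$, $y\sim_J z$ means $y\mathfrak S_J=z\mathfrak S_J$ where $\mathfrak S_J$ is generated by $J$. $\widetilde P_{x,J}$ is the linear map on $H_n^A$ with $\widetilde P_{x,J}(\widetilde T_v)=\widetilde T_v$ if $v\sim_J x$ and $0$ otherwise. $\mathrm{rw}(v)$ is the set of generators occurring in a reduced expression of $v$. -}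

module Defs where

open import Data.Nat as ℕ using (ℕ; zero; suc)
open import Data.Fin as Fin using (Fin; inject₁)
open import Data.Fin.Properties using (_≟_)
import Data.Fin as F
open import Data.Fin.Subset using (Subset) renaming (_∈_ to _∈ₛ_)
open import Data.Integer as ℤ using (ℤ)
open import Data.Vec as Vec using (Vec; lookup; tabulate)
open import Data.Vec.Properties using (≡-dec)
open import Data.List as List using (List; []; _∷_)
open import Data.List.Relation.Unary.All using (All)
open import Data.Nat.ListAction using (sum)
open import Data.Bool using (Bool; true; false; if_then_else_; _∧_)
open import Data.Product using (∃; _×_)
open import Relation.Nullary using (Dec; does)
open import Relation.Binary.PropositionalEquality using (_≡_)

-- Elements of 𝔖_n (n = suc m) in one-line notation: u = [u(0),…,u(n-1)].
Arr : ℕ → Set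
Arr n = Vec (Fin n) n

IsPerm : ∀ {n} → Arr n → Set
IsPerm {n} x = ∀ (j : Fin n) → ∃ λ i → lookup x i ≡ j

comp : ∀ {n} → Arr n → Arr n → Arr n
comp y z = Vec.map (lookup y) z

swap : ∀ {m} → Fin m → Fin (suc m) → Fin (suc m)
swap i j =
  if does (j ≟ inject₁ i) then F.suc i
  else (if does (j ≟ F.suc i) then inject₁ i else j)

sVec : ∀ {m} → Fin m → Arr (suc m)
sVec i = tabulate (swap i)

lmul : ∀ {m} → Fin m → Arr (suc m) → Arr (suc m)
lmul i u = Vec.map (swap i) u

rmul : ∀ {m} → Arr (suc m) → Fin m → Arr (suc m)
rmul u i = comp u (sVec i)

eval : ∀ {m} → List (Fin m) → Arr (suc m)
eval []       = Vec.allFin _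
eval (i ∷ is) = lmul i (eval is)

-- Coxeter length of a permutation = number of inversions
inv : ∀ {n} → Arr n → ℕ
inv {n} u = sum (List.map (λ a → sum (List.map (λ b → cnt a b) (List.allFin n))) (List.allFin n))
  where
  cnt : Fin n → Fin n → ℕ
  cnt a b = if does (a F.<? b) ∧ does (lookup u b F.<? lookup u a) then 1 else 0

Reduced : ∀ {m} → List (Fin m) → Arr (suc m) → Set
Reduced ρ v = (eval ρ ≡ v) × (List.length ρ ≡ inv v)

-- y ∼_J z  :⟺  y 𝔖_J = z 𝔖_J  ⟺  z = y·g with g a product of generators in J
_∼[_]_ : ∀ {m} → Arr (suc m) → Subset m → Arr (suc m) → Set
y ∼[ J ] z = ∃ λ (ws : List (Fin _)) → All (_∈ₛ J) ws × (z ≡ comp y (eval ws))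

-- Hecke algebra H_n (n = suc m) over ℤ[v,v⁻¹], v = q^{1/2}:
-- h u k = coefficient of v^k · T̃_u in h.
H : ℕ → Set
H m = Arr (suc m) → ℤ → ℤ

_≋_ : ∀ {m} → H m → H m → Set
h ≋ h' = ∀ u k → h u k ≡ h' u k

T : ∀ {m} → Arr (suc m) → H m
T x u k = if does (≡-dec _≟_ u x) ∧ does (k ℤ.≟ ℤ.0ℤ) then ℤ.1ℤ else ℤ.0ℤ

-- left multiplication by T̃_{s_i}:  T̃_s T̃_w = T̃_{sw} if ℓ(sw) > ℓ(w),
-- and T̃_{sw} + (v - v⁻¹) T̃_w otherwise.
Ts : ∀ {m} → Fin m → H m → H m
Ts i h u k = h (lmul i u) k ℤ.+
  (if does (inv (lmul i u) ℕ.<? inv u)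
   then h u (k ℤ.- ℤ.1ℤ) ℤ.- h u (k ℤ.+ ℤ.1ℤ)
   else ℤ.0ℤ)

actW : ∀ {m} → List (Fin m) → H m → H m
actW []       h = h
actW (i ∷ is) h = Ts i (actW is h)

P : ∀ {m} (x : Arr (suc m)) (J : Subset m) → (∀ u → Dec (u ∼[ J ] x)) → H m → H m
P x J dec h u k = if does (dec u) then h u k else ℤ.0ℤ

-- T̃_σ T̃_x does not depend on the reduced word σ of w: writing T̃_x = T̃_e T̃_τ with right multiplications,
-- which commute with left ones, gives T̃_σ T̃_x = T̃_w T̃_τ. Hence T̃_{w's} T̃_x = T̃_{w'} (T̃_s T̃_x), and T̃_s T̃_x
-- differs from its projection at most at T̃_{sx}, when sx ≁_J x. Since s ∉ rw(w'), the coefficient of T̃_u in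
-- T̃_{w'} h only involves coefficients of h at g u with s ∉ g. So it remains to see that u ∼_J x and s g u = x
-- force g u ∼_J x. Label each value by the J-block of its position in x; then s g preserves labels. As g
-- preserves {0, …, s} while s moves only s out of it, counting labels there shows that s and s + 1 carry the
-- same label, i.e. s x = x (p q) with (p q) ∈ 𝔖_J.

module Submission where

open import Defs
open import Algebra.Definitions using (Involutive)
open import Data.Bool as Bool using (Bool; true; false; if_then_else_; _∧_)
open import Data.Empty using (⊥; ⊥-elim)
open import Data.Fin as F using (Fin; inject₁; toℕ; punchIn; punchOut)
open import Data.Fin.Induction using (<-weakInduction; >-weakInduction)
open import Data.Fin.Permutation using (permutation)
open import Data.Fin.Permutation.Components using (transpose)
open import Data.Fin.Properties as FP using (_≟_; _<?_; toℕ-inject₁; toℕ-injective)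
open import Data.Fin.Subset using (Subset) renaming (_∈_ to _∈ₛ_)
open import Data.Integer as ℤ using (ℤ)
import Data.Integer.Properties as ZP
open import Data.Integer.Tactic.RingSolver using (solve-∀)
open import Data.List as List using (List; []; _∷_; _++_)
import Data.List.Properties as LP
open import Data.List.Membership.Propositional using (_∉_)
open import Data.List.Membership.Propositional.Properties using (∈-++⁻)
open import Data.List.Relation.Unary.All using (All; []; _∷_)
open import Data.List.Relation.Unary.All.Properties using (++⁺)
open import Data.List.Relation.Unary.Any using (here; there)
open import Data.Nat as ℕ using (ℕ; zero; suc; _+_; z≤n; s≤s)
open import Data.Nat.Induction using (<-wellFounded)
import Data.Nat.ListAction as ListAction
import Data.Nat.Properties as NP
open import Algebra.Properties.CommutativeMonoid.Sum NP.+-0-commutativeMonoid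
  using (sum; sum-remove; sum-permute; sum-cong-≗; sum-replicate-zero)
open import Data.Product using (∃; _×_; _,_; proj₁; proj₂)
open import Data.Sum using (_⊎_; inj₁; inj₂; [_,_])
open import Data.Vec as Vec using (lookup; tabulate; _∷_)
open import Data.Vec.Functional using (removeAt)
import Data.Vec.Properties as VP
open import Function using (_∘_)
open import Induction.WellFounded using (Acc; acc)
open import Relation.Binary.Definitions using (tri<; tri≈; tri>)
open import Relation.Binary.PropositionalEquality hiding ([_])
open import Relation.Nullary using (Dec; yes; no; does; ¬_; _×-dec_; _⊎-dec_)
open import Relation.Nullary.Decidable using (dec-true; dec-false)

-- Simple transpositions

module _ {m : ℕ} (i : Fin m) where
  lo hi : Fin (suc m)
  lo = inject₁ i
  hi = F.suc i

  toℕ-lo : toℕ lo ≡ toℕ i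
  toℕ-lo = toℕ-inject₁ i

  lo<hi : lo F.< hi
  lo<hi = s≤s (NP.≤-reflexive toℕ-lo)

  lo≢hi : lo ≢ hi
  lo≢hi e = NP.<-irrefl (cong toℕ e) lo<hi

  swap-lo : swap i lo ≡ hi
  swap-lo rewrite dec-true (lo ≟ lo) refl = refl

  swap-hi : swap i hi ≡ lo
  swap-hi rewrite dec-false (hi ≟ lo) (lo≢hi ∘ sym) | dec-true (hi ≟ hi) refl = refl

  swap-other : ∀ {j} → j ≢ lo → j ≢ hi → swap i j ≡ j
  swap-other {j} j≢lo j≢hi rewrite dec-false (j ≟ lo) j≢lo | dec-false (j ≟ hi) j≢hi = refl

  data SwapCase (j : Fin (suc m)) : Set where
    at-lo : j ≡ lo → SwapCase j
    at-hi : j ≡ hi → SwapCase j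
    apart : j ≢ lo → j ≢ hi → SwapCase j

  swapCase : ∀ j → SwapCase j
  swapCase j with j ≟ lo | j ≟ hi
  ... | yes j≡lo | _        = at-lo j≡lo
  ... | no _     | yes j≡hi = at-hi j≡hi
  ... | no j≢lo  | no j≢hi  = apart j≢lo j≢hi

  swap-involutive : Involutive _≡_ (swap i)
  swap-involutive j with swapCase j
  ... | at-lo refl = trans (cong (swap i) swap-lo) swap-hi
  ... | at-hi refl = trans (cong (swap i) swap-hi) swap-lo
  ... | apart j≢lo j≢hi = trans (cong (swap i) (swap-other j≢lo j≢hi)) (swap-other j≢lo j≢hi)

  IsSwapPair : Fin (suc m) → Fin (suc m) → Set
  IsSwapPair a b = (a ≡ lo × b ≡ hi) ⊎ (a ≡ hi × b ≡ lo)

  swap-mono-< : ∀ {a b} → a F.< b → ¬ (a ≡ lo × b ≡ hi) → swap i a F.< swap i b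
  swap-mono-< {a} {b} a<b not-lo-hi with swapCase a | swapCase b
  ... | at-lo refl | at-lo refl = ⊥-elim (NP.<-irrefl refl a<b)
  ... | at-lo refl | at-hi refl = ⊥-elim (not-lo-hi (refl , refl))
  ... | at-lo refl | apart _ b≢hi
    rewrite swap-lo | swap-other {b} (λ { refl → NP.<-irrefl refl a<b }) b≢hi =
      NP.≤∧≢⇒< (subst (λ n → suc n ℕ.≤ toℕ b) toℕ-lo a<b) (λ e → b≢hi (toℕ-injective (sym e)))
  ... | at-hi refl | at-lo refl = ⊥-elim (NP.<-asym a<b lo<hi)
  ... | at-hi refl | at-hi refl = ⊥-elim (NP.<-irrefl refl a<b)
  ... | at-hi refl | apart b≢lo b≢hi rewrite swap-hi | swap-other b≢lo b≢hi = NP.<-trans lo<hi a<b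
  ... | apart a≢lo a≢hi | at-lo refl rewrite swap-lo | swap-other a≢lo a≢hi = NP.<-trans a<b lo<hi
  ... | apart a≢lo a≢hi | at-hi refl rewrite swap-hi | swap-other a≢lo a≢hi =
      NP.≤∧≢⇒< (subst (toℕ a ℕ.≤_) (sym toℕ-lo) (NP.≤-pred a<b)) (a≢lo ∘ toℕ-injective)
  ... | apart a≢lo a≢hi | apart b≢lo b≢hi rewrite swap-other a≢lo a≢hi | swap-other b≢lo b≢hi = a<b

  IsSwapPair-sym : ∀ {a b} → IsSwapPair a b → IsSwapPair b a
  IsSwapPair-sym (inj₁ (a≡lo , b≡hi)) = inj₂ (b≡hi , a≡lo)
  IsSwapPair-sym (inj₂ (a≡hi , b≡lo)) = inj₁ (b≡lo , a≡hi)

  IsSwapPair? : ∀ a b → Dec (IsSwapPair a b)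
  IsSwapPair? a b = (a ≟ lo ×-dec b ≟ hi) ⊎-dec (a ≟ hi ×-dec b ≟ lo)

  swap-pair : ∀ {a b} → IsSwapPair a b → swap i a ≡ b
  swap-pair (inj₁ (refl , refl)) = swap-lo
  swap-pair (inj₂ (refl , refl)) = swap-hi

  swap-outside-pair : ∀ {a b c} → IsSwapPair a b → c ≢ a → c ≢ b → swap i c ≡ c
  swap-outside-pair (inj₁ (refl , refl)) c≢lo c≢hi = swap-other c≢lo c≢hi
  swap-outside-pair (inj₂ (refl , refl)) c≢hi c≢lo = swap-other c≢lo c≢hi

  swap-preserves-<? : ∀ a b → ¬ IsSwapPair a b → does (swap i a <? swap i b) ≡ does (a <? b)
  swap-preserves-<? a b not-pair with NP.<-cmp (toℕ a) (toℕ b)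
  ... | tri< a<b _ _ =
    trans (dec-true (swap i a <? swap i b) (swap-mono-< a<b (not-pair ∘ inj₁))) (sym (dec-true (a <? b) a<b))
  ... | tri≈ _ a≡b _ rewrite toℕ-injective {i = a} {j = b} a≡b =
    trans (dec-false (swap i b <? swap i b) (NP.<-irrefl refl)) (sym (dec-false (b <? b) (NP.<-irrefl refl)))
  ... | tri> _ _ b<a =
    trans (dec-false (swap i a <? swap i b)
                     (NP.<-asym (swap-mono-< b<a λ { (b≡lo , a≡hi) → not-pair (inj₂ (a≡hi , b≡lo)) })))
          (sym (dec-false (a <? b) (NP.<-asym b<a)))

-- Permutations in one-line notation

lookup-ext : ∀ {n} {u v : Arr n} → lookup u ≗ lookup v → u ≡ v
lookup-ext {u = u} {v} u≗v = trans (sym (VP.tabulate∘lookup u)) (trans (VP.tabulate-cong u≗v) (VP.tabulate∘lookup v))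

IsPerm⇒injective : ∀ {n} {u : Arr n} → IsPerm u → ∀ {a b} → lookup u a ≡ lookup u b → a ≡ b
IsPerm⇒injective {zero} _ {()}
IsPerm⇒injective {suc n} {u} u-onto {a} {b} ua≡ub with a ≟ b
... | yes a≡b = a≡b
... | no a≢b = ⊥-elim (section-not-injective (missed (section (lookup u a) ≟ a)))
  where
  section : Fin (suc n) → Fin (suc n)
  section v = proj₁ (u-onto v)
  u∘section : ∀ v → lookup u (section v) ≡ v
  u∘section v = proj₂ (u-onto v)
  section-injective : ∀ {v w} → section v ≡ section w → v ≡ w
  section-injective {v} {w} e = trans (sym (u∘section v)) (trans (cong (lookup u) e) (u∘section w))
  -- a and b have the same image, so the section cannot hit both of them
  missed : Dec (section (lookup u a) ≡ a) → ∃ λ z → ∀ v → section v ≢ z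
  missed (no  sa≢a) = a , λ v sv≡a →
    sa≢a (trans (cong section (sym (trans (sym (u∘section v)) (cong (lookup u) sv≡a)))) sv≡a)
  missed (yes sa≡a) = b , λ v sv≡b →
    a≢b (trans (sym sa≡a)
               (trans (cong section (trans ua≡ub (sym (trans (sym (u∘section v)) (cong (lookup u) sv≡b))))) sv≡b))
  section-not-injective : (∃ λ z → ∀ v → section v ≢ z) → ⊥
  section-not-injective (z , miss)
    with i , j , i<j , eq ← FP.pigeonhole (NP.n<1+n n) (λ v → punchOut {i = z} {j = section v} (miss v ∘ sym))
    = NP.<-irrefl (cong toℕ (section-injective (FP.punchOut-injective (miss i ∘ sym) (miss j ∘ sym) eq))) i<j

module _ {m : ℕ} where
  lookup-lmul : ∀ i (u : Arr (suc m)) r → lookup (lmul i u) r ≡ swap i (lookup u r)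
  lookup-lmul i u r = VP.lookup-map r (swap i) u

  lookup-rmul : ∀ (u : Arr (suc m)) j r → lookup (rmul u j) r ≡ lookup u (swap j r)
  lookup-rmul u j r =
    trans (VP.lookup-map r (lookup u) (tabulate (swap j))) (cong (lookup u) (VP.lookup∘tabulate (swap j) r))

  lookup-rmul-swap : ∀ (u : Arr (suc m)) j r → lookup (rmul u j) (swap j r) ≡ lookup u r
  lookup-rmul-swap u j r = trans (lookup-rmul u j (swap j r)) (cong (lookup u) (swap-involutive j r))

  lmul-involutive : ∀ i → Involutive _≡_ (lmul {m} i)
  lmul-involutive i u = lookup-ext λ r →
    trans (lookup-lmul i (lmul i u) r) (trans (cong (swap i) (lookup-lmul i u r)) (swap-involutive i (lookup u r)))

  rmul-involutive : ∀ j → Involutive _≡_ (λ (u : Arr (suc m)) → rmul u j)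
  rmul-involutive j u = lookup-ext λ r → trans (lookup-rmul (rmul u j) j r) (lookup-rmul-swap u j r)

  lmul-rmul-comm : ∀ i (u : Arr (suc m)) j → lmul i (rmul u j) ≡ rmul (lmul i u) j
  lmul-rmul-comm i u j = lookup-ext λ r → begin
    lookup (lmul i (rmul u j)) r  ≡⟨ lookup-lmul i (rmul u j) r ⟩
    swap i (lookup (rmul u j) r)  ≡⟨ cong (swap i) (lookup-rmul u j r) ⟩
    swap i (lookup u (swap j r))  ≡⟨ lookup-lmul i u (swap j r) ⟨
    lookup (lmul i u) (swap j r)  ≡⟨ lookup-rmul (lmul i u) j r ⟨
    lookup (rmul (lmul i u) j) r  ∎
    where open ≡-Reasoning

  lmul-perm : ∀ i (u : Arr (suc m)) → IsPerm u → IsPerm (lmul i u)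
  lmul-perm i u u-onto v with r , ur≡ ← u-onto (swap i v) =
    r , trans (lookup-lmul i u r) (trans (cong (swap i) ur≡) (swap-involutive i v))

  rmul-perm : ∀ (u : Arr (suc m)) j → IsPerm u → IsPerm (rmul u j)
  rmul-perm u j u-onto v with r , ur≡ ← u-onto v =
    swap j r , trans (lookup-rmul-swap u j r) ur≡

  apply : List (Fin m) → Fin (suc m) → Fin (suc m)
  apply ws r = List.foldr swap r ws

  lookup-eval : ∀ ws r → lookup (eval ws) r ≡ apply ws r
  lookup-eval []       r = VP.lookup-allFin r
  lookup-eval (i ∷ ws) r = trans (lookup-lmul i (eval ws) r) (cong (swap i) (lookup-eval ws r))

  apply-++ : ∀ (ρ g : List (Fin m)) r → apply (ρ ++ g) r ≡ apply ρ (apply g r)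
  apply-++ ρ g r = LP.foldr-++ swap r ρ g

  lmulW : List (Fin m) → Arr (suc m) → Arr (suc m)
  lmulW g u = List.foldr lmul u g

  lookup-lmulW : ∀ g (u : Arr (suc m)) r → lookup (lmulW g u) r ≡ apply g (lookup u r)
  lookup-lmulW []      u r = refl
  lookup-lmulW (i ∷ g) u r = trans (lookup-lmul i (lmulW g u) r) (cong (swap i) (lookup-lmulW g u r))

  lookup-comp : ∀ (y z : Arr (suc m)) r → lookup (comp y z) r ≡ lookup y (lookup z r)
  lookup-comp y z r = VP.lookup-map r (lookup y) z

  eval-perm : ∀ ws → IsPerm (eval ws)
  eval-perm []       v = v , VP.lookup-allFin v
  eval-perm (i ∷ ws) = lmul-perm i (eval ws) (eval-perm ws)

-- Inversions and descents

sum-removeAt-agree : ∀ {n} {f g : Fin (suc n) → ℕ} c → (∀ a → a ≢ c → f a ≡ g a) →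
                     sum (removeAt f c) ≡ sum (removeAt g c)
sum-removeAt-agree c agree = sum-cong-≗ λ j → agree (punchIn c j) (FP.punchInᵢ≢i c j)

sum-increment-at : ∀ {n} {f g : Fin n → ℕ} c → (∀ a → a ≢ c → f a ≡ g a) → g c ≡ suc (f c) →
                   sum g ≡ suc (sum f)
sum-increment-at {suc n} {f} {g} c agree gc≡ = begin
  sum g                           ≡⟨ sum-remove g ⟩
  g c + sum (removeAt g c)        ≡⟨ cong₂ _+_ gc≡ (sym (sum-removeAt-agree c agree)) ⟩
  suc (f c + sum (removeAt f c))  ≡⟨ cong suc (sum-remove f) ⟨
  suc (sum f)                     ∎
  where open ≡-Reasoning

sum-agree-at : ∀ {n} {f g : Fin n → ℕ} c → (∀ a → a ≢ c → f a ≡ g a) → sum f ≡ sum g → f c ≡ g c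
sum-agree-at {suc n} {f} {g} c agree Σf≡Σg = NP.+-cancelʳ-≡ (sum (removeAt f c)) (f c) (g c) (begin
  f c + sum (removeAt f c)  ≡⟨ sum-remove f ⟨
  sum f                     ≡⟨ Σf≡Σg ⟩
  sum g                     ≡⟨ sum-remove g ⟩
  g c + sum (removeAt g c)  ≡⟨ cong (g c +_) (sum-removeAt-agree c agree) ⟨
  g c + sum (removeAt f c)  ∎)
  where open ≡-Reasoning

sum-swap : ∀ {m} j (f : Fin (suc m) → ℕ) → sum (f ∘ swap j) ≡ sum f
sum-swap j f = sym (sum-permute f (permutation (swap j) (swap j) (swap-involutive j) (swap-involutive j)))

∑∑-increment-at : ∀ {n} {F G : Fin n → Fin n → ℕ} p q → (∀ a b → ¬ (a ≡ p × b ≡ q) → F a b ≡ G a b) →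
                  G p q ≡ suc (F p q) → sum (λ a → sum (G a)) ≡ suc (sum (λ a → sum (F a)))
∑∑-increment-at p q agree Gpq≡ =
  sum-increment-at p (λ a a≢p → sum-cong-≗ λ b → agree a b (a≢p ∘ proj₁))
                     (sum-increment-at q (λ b b≢q → agree p b (b≢q ∘ proj₂)) Gpq≡)

listSum-allFin : ∀ {n} (f : Fin n → ℕ) → ListAction.sum (List.map f (List.allFin n)) ≡ sum f
listSum-allFin f = trans (cong ListAction.sum (LP.map-tabulate (λ a → a) f)) (listSum-tabulate f)
  where
  listSum-tabulate : ∀ {n} (f : Fin n → ℕ) → ListAction.sum (List.tabulate f) ≡ sum f
  listSum-tabulate {zero}  f = refl
  listSum-tabulate {suc n} f = cong (f F.zero +_) (listSum-tabulate (f ∘ F.suc))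

inversion : ∀ {n} → Arr n → Fin n → Fin n → ℕ
inversion u a b = if does (a <? b) ∧ does (lookup u b <? lookup u a) then 1 else 0

inv≡∑∑inversion : ∀ {n} (u : Arr n) → inv u ≡ sum (λ a → sum (inversion u a))
inv≡∑∑inversion u =
  trans (cong ListAction.sum (LP.map-cong (λ a → listSum-allFin (inversion u a)) (List.allFin _)))
        (listSum-allFin (λ a → sum (inversion u a)))

module _ {n : ℕ} where
  inversion-cong : ∀ {u v : Arr n} {a b c d} →
                   (a F.< b → does (lookup v d <? lookup v c) ≡ does (lookup u b <? lookup u a)) →
                   does (c <? d) ≡ does (a <? b) → inversion v c d ≡ inversion u a b
  inversion-cong {u} {v} {a} {b} {c} {d} values≡ positions≡ with a <? b
  ... | yes a<b = cong₂ (λ x y → if x ∧ y then 1 else 0) positions≡ (values≡ a<b)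
  ... | no  a≮b =
    trans (cong (λ x → if x ∧ does (lookup v d <? lookup v c) then 1 else 0) (trans positions≡ (dec-false (a <? b) a≮b)))
          (cong (λ x → if x ∧ does (lookup u b <? lookup u a) then 1 else 0) (sym (dec-false (a <? b) a≮b)))

  inversion-yes : ∀ {u : Arr n} {a b} → a F.< b → lookup u b F.< lookup u a → inversion u a b ≡ 1
  inversion-yes {u} {a} {b} a<b ub<ua rewrite dec-true (a <? b) a<b | dec-true (lookup u b <? lookup u a) ub<ua = refl

  inversion-no : ∀ {u : Arr n} {a b} → ¬ (lookup u b F.< lookup u a) → inversion u a b ≡ 0
  inversion-no {u} {a} {b} ub≮ua rewrite dec-false (lookup u b <? lookup u a) ub≮ua with does (a <? b)
  ... | true  = refl
  ... | false = refl

  inversion-unordered : ∀ {u : Arr n} {a b} → ¬ (a F.< b) → inversion u a b ≡ 0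
  inversion-unordered {u} {a} {b} a≮b rewrite dec-false (a <? b) a≮b = refl

module _ {m : ℕ} where
  inv-lmul-ascent : ∀ i (u : Arr (suc m)) → IsPerm u → ∀ {p q} → lookup u p ≡ lo i → lookup u q ≡ hi i →
                    p F.< q → inv (lmul i u) ≡ suc (inv u)
  inv-lmul-ascent i u u-perm {p} {q} up uq p<q rewrite inv≡∑∑inversion u | inv≡∑∑inversion (lmul i u) =
    ∑∑-increment-at {F = inversion u} {G = inversion (lmul i u)} p q agree new
    where
    inj : ∀ {a b} → lookup u a ≡ lookup u b → a ≡ b
    inj = IsPerm⇒injective {u = u} u-perm
    su-q : lookup (lmul i u) q ≡ lo i
    su-q = trans (lookup-lmul i u q) (trans (cong (swap i) uq) (swap-hi i))
    su-p : lookup (lmul i u) p ≡ hi i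
    su-p = trans (lookup-lmul i u p) (trans (cong (swap i) up) (swap-lo i))
    agree : ∀ a b → ¬ (a ≡ p × b ≡ q) → inversion u a b ≡ inversion (lmul i u) a b
    agree a b not-pq = sym (inversion-cong {u = u} {lmul i u} {a} {b} values≡ refl)
      where
      not-pair : a F.< b → ¬ IsSwapPair i (lookup u b) (lookup u a)
      not-pair a<b (inj₁ (ub≡lo , ua≡hi)) =
        NP.<-asym p<q (subst₂ F._<_ (inj (trans ua≡hi (sym uq))) (inj (trans ub≡lo (sym up))) a<b)
      not-pair a<b (inj₂ (ub≡hi , ua≡lo)) = not-pq (inj (trans ua≡lo (sym up)) , inj (trans ub≡hi (sym uq)))
      values≡ : a F.< b → does (lookup (lmul i u) b <? lookup (lmul i u) a) ≡ does (lookup u b <? lookup u a)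
      values≡ a<b = trans (cong₂ (λ x y → does (x <? y)) (lookup-lmul i u b) (lookup-lmul i u a))
                          (swap-preserves-<? i _ _ (not-pair a<b))
    new : inversion (lmul i u) p q ≡ suc (inversion u p q)
    new = trans (inversion-yes {u = lmul i u} {p} {q} p<q (subst₂ F._<_ (sym su-q) (sym su-p) (lo<hi i)))
                (cong suc (sym (inversion-no {u = u} {p} {q}
                                  (subst₂ (λ x y → ¬ x F.< y) (sym uq) (sym up) (NP.<-asym (lo<hi i))))))

  inv-rmul-ascent : ∀ (u : Arr (suc m)) j → lookup u (lo j) F.< lookup u (hi j) → inv (rmul u j) ≡ suc (inv u)
  inv-rmul-ascent u j ulo<uhi rewrite inv≡∑∑inversion u | inv≡∑∑inversion (rmul u j) = begin
    sum (λ a → sum (inversion (rmul u j) a))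
      ≡⟨ sum-swap j (λ a → sum (inversion (rmul u j) a)) ⟨
    sum (λ a → sum (inversion (rmul u j) (swap j a)))
      ≡⟨ sum-cong-≗ (λ a → sum-swap j (inversion (rmul u j) (swap j a))) ⟨
    sum (λ a → sum (λ b → inversion (rmul u j) (swap j a) (swap j b)))
      ≡⟨ ∑∑-increment-at {F = inversion u} (hi j) (lo j) agree new ⟩
    suc (sum (λ a → sum (inversion u a)))
      ∎
    where
    open ≡-Reasoning
    conjugated : ∀ a b → inversion (rmul u j) (swap j a) (swap j b) ≡
                         (if does (swap j a <? swap j b) ∧ does (lookup u b <? lookup u a) then 1 else 0)
    conjugated a b = cong₂ (λ x y → if does (swap j a <? swap j b) ∧ does (x <? y) then 1 else 0)
                           (lookup-rmul-swap u j b) (lookup-rmul-swap u j a)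
    agree : ∀ a b → ¬ (a ≡ hi j × b ≡ lo j) → inversion u a b ≡ inversion (rmul u j) (swap j a) (swap j b)
    agree a b not-hi-lo = by-cases (a ≟ lo j ×-dec b ≟ hi j)
      where
      by-cases : Dec (a ≡ lo j × b ≡ hi j) → inversion u a b ≡ inversion (rmul u j) (swap j a) (swap j b)
      by-cases (yes (a≡lo , b≡hi)) rewrite a≡lo | b≡hi =
        trans (inversion-no {u = u} {lo j} {hi j} (NP.<-asym ulo<uhi))
              (sym (trans (cong₂ (inversion (rmul u j)) (swap-lo j) (swap-hi j))
                          (inversion-unordered {u = rmul u j} {hi j} {lo j} (NP.<-asym (lo<hi j)))))
      by-cases (no not-lo-hi) =
        sym (trans (conjugated a b) (cong (λ x → if x ∧ does (lookup u b <? lookup u a) then 1 else 0)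
                                          (swap-preserves-<? j a b [ not-lo-hi , not-hi-lo ])))
    ut-lo : lookup (rmul u j) (lo j) ≡ lookup u (hi j)
    ut-lo = trans (lookup-rmul u j (lo j)) (cong (lookup u) (swap-lo j))
    ut-hi : lookup (rmul u j) (hi j) ≡ lookup u (lo j)
    ut-hi = trans (lookup-rmul u j (hi j)) (cong (lookup u) (swap-hi j))
    new : inversion (rmul u j) (swap j (hi j)) (swap j (lo j)) ≡ suc (inversion u (hi j) (lo j))
    new = trans (cong₂ (inversion (rmul u j)) (swap-hi j) (swap-lo j))
                (trans (inversion-yes {u = rmul u j} {lo j} {hi j} (lo<hi j) (subst₂ F._<_ (sym ut-hi) (sym ut-lo) ulo<uhi))
                       (cong suc (sym (inversion-unordered {u = u} {hi j} {lo j} (NP.<-asym (lo<hi j))))))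

  inv-lmul-descent : ∀ i (u : Arr (suc m)) → IsPerm u → ∀ {p q} → lookup u p ≡ lo i → lookup u q ≡ hi i →
                     q F.< p → inv u ≡ suc (inv (lmul i u))
  inv-lmul-descent i u u-perm {p} {q} up uq q<p =
    trans (cong inv (sym (lmul-involutive i u)))
          (inv-lmul-ascent i (lmul i u) (lmul-perm i u u-perm)
            (trans (lookup-lmul i u q) (trans (cong (swap i) uq) (swap-hi i)))
            (trans (lookup-lmul i u p) (trans (cong (swap i) up) (swap-lo i))) q<p)

  inv-rmul-descent : ∀ (u : Arr (suc m)) j → lookup u (hi j) F.< lookup u (lo j) → inv u ≡ suc (inv (rmul u j))
  inv-rmul-descent u j uhi<ulo =
    trans (cong inv (sym (rmul-involutive j u)))
          (inv-rmul-ascent (rmul u j) j (subst₂ F._<_ (sym (trans (lookup-rmul u j (lo j)) (cong (lookup u) (swap-lo j))))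
                                           (sym (trans (lookup-rmul u j (hi j)) (cong (lookup u) (swap-hi j)))) uhi<ulo))

  descends : (Arr (suc m) → Arr (suc m)) → Arr (suc m) → Bool
  descends f u = does (inv (f u) ℕ.<? inv u)

  descends-if-ascent : ∀ {f u} → inv (f u) ≡ suc (inv u) → descends f u ≡ false
  descends-if-ascent {f} {u} up = dec-false (inv (f u) ℕ.<? inv u) (λ lt → NP.<-asym lt (NP.≤-reflexive (sym up)))

  descends-if-descent : ∀ {f u} → inv u ≡ suc (inv (f u)) → descends f u ≡ true
  descends-if-descent {f} {u} down = dec-true (inv (f u) ℕ.<? inv u) (NP.≤-reflexive (sym down))

  descends-lmul : ∀ i (u : Arr (suc m)) → IsPerm u → ∀ {p q} → lookup u p ≡ lo i → lookup u q ≡ hi i →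
                  descends (lmul i) u ≡ does (q <? p)
  descends-lmul i u u-perm {p} {q} up uq with NP.<-cmp (toℕ p) (toℕ q)
  ... | tri< p<q _ _ = trans (descends-if-ascent {lmul i} {u} (inv-lmul-ascent i u u-perm up uq p<q))
                             (sym (dec-false (q <? p) (NP.<-asym p<q)))
  ... | tri≈ _ p≡q _ = ⊥-elim (lo≢hi i (trans (sym up) (trans (cong (lookup u) (toℕ-injective p≡q)) uq)))
  ... | tri> _ _ q<p = trans (descends-if-descent {lmul i} {u} (inv-lmul-descent i u u-perm up uq q<p))
                             (sym (dec-true (q <? p) q<p))

  descends-rmul : ∀ (u : Arr (suc m)) j → IsPerm u →
                  descends (λ w → rmul w j) u ≡ does (lookup u (hi j) <? lookup u (lo j))
  descends-rmul u j u-perm with NP.<-cmp (toℕ (lookup u (lo j))) (toℕ (lookup u (hi j)))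
  ... | tri< lo<hi' _ _ = trans (descends-if-ascent {λ w → rmul w j} {u} (inv-rmul-ascent u j lo<hi'))
                                (sym (dec-false (_ <? _) (NP.<-asym lo<hi')))
  ... | tri≈ _ eq _     = ⊥-elim (lo≢hi j (IsPerm⇒injective {u = u} u-perm (toℕ-injective eq)))
  ... | tri> _ _ hi<lo' = trans (descends-if-descent {λ w → rmul w j} {u} (inv-rmul-descent u j hi<lo'))
                                (sym (dec-true (_ <? _) hi<lo'))

  inv-lmul-≤ : ∀ i (u : Arr (suc m)) → IsPerm u → inv (lmul i u) ℕ.≤ suc (inv u)
  inv-lmul-≤ i u u-perm with p , up ← u-perm (lo i) | q , uq ← u-perm (hi i) | NP.<-cmp (toℕ p) (toℕ q)
  ... | tri< p<q _ _ = NP.≤-reflexive (inv-lmul-ascent i u u-perm up uq p<q)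
  ... | tri≈ _ p≡q _ = ⊥-elim (lo≢hi i (trans (sym up) (trans (cong (lookup u) (toℕ-injective p≡q)) uq)))
  ... | tri> _ _ q<p =
    NP.≤-trans (NP.n≤1+n _) (NP.≤-trans (NP.≤-reflexive (sym (inv-lmul-descent i u u-perm up uq q<p))) (NP.n≤1+n _))

  lmul-rmul-fixed : ∀ i j {u : Arr (suc m)} → IsPerm u → IsSwapPair i (lookup u (lo j)) (lookup u (hi j)) →
                    lmul i (rmul u j) ≡ u
  lmul-rmul-fixed i j {u} u-perm pair = lookup-ext λ r →
    trans (lookup-lmul i (rmul u j) r) (trans (cong (swap i) (lookup-rmul u j r)) (at r (swapCase j r)))
    where
    inj : ∀ {a b} → lookup u a ≡ lookup u b → a ≡ b
    inj = IsPerm⇒injective {u = u} u-perm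
    at : ∀ r → SwapCase j r → swap i (lookup u (swap j r)) ≡ lookup u r
    at r (at-lo refl) = trans (cong (swap i ∘ lookup u) (swap-lo j)) (swap-pair i (IsSwapPair-sym i pair))
    at r (at-hi refl) = trans (cong (swap i ∘ lookup u) (swap-hi j)) (swap-pair i pair)
    at r (apart r≢lo r≢hi) = trans (cong (swap i ∘ lookup u) (swap-other j r≢lo r≢hi))
                                  (swap-outside-pair i pair (r≢lo ∘ inj) (r≢hi ∘ inj))

-- Left and right Hecke multiplication

when : Bool → ℤ → ℤ
when b z = if b then z else ℤ.0ℤ

when-0 : ∀ b → when b ℤ.0ℤ ≡ ℤ.0ℤ
when-0 true  = refl
when-0 false = refl

when-interchange : ∀ b c (A D₋ D₊ X₋ X₊ Y₋ Y₊ : ℤ) →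
  A ℤ.+ when c (D₋ ℤ.- D₊) ℤ.+ when b ((X₋ ℤ.+ when c Y₋) ℤ.- (X₊ ℤ.+ when c Y₊)) ≡
  A ℤ.+ when b (X₋ ℤ.- X₊) ℤ.+ when c ((D₋ ℤ.+ when b Y₋) ℤ.- (D₊ ℤ.+ when b Y₊))
when-interchange true true = ring
  where
  ring : ∀ (A D₋ D₊ X₋ X₊ Y₋ Y₊ : ℤ) →
         A ℤ.+ (D₋ ℤ.- D₊) ℤ.+ ((X₋ ℤ.+ Y₋) ℤ.- (X₊ ℤ.+ Y₊)) ≡ A ℤ.+ (X₋ ℤ.- X₊) ℤ.+ ((D₋ ℤ.+ Y₋) ℤ.- (D₊ ℤ.+ Y₊))
  ring = solve-∀
when-interchange true false A _ _ X₋ X₊ _ _ = ring A X₋ X₊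
  where
  ring : ∀ (A X₋ X₊ : ℤ) → A ℤ.+ ℤ.0ℤ ℤ.+ ((X₋ ℤ.+ ℤ.0ℤ) ℤ.- (X₊ ℤ.+ ℤ.0ℤ)) ≡ A ℤ.+ (X₋ ℤ.- X₊) ℤ.+ ℤ.0ℤ
  ring = solve-∀
when-interchange false true A D₋ D₊ _ _ _ _ = ring A D₋ D₊
  where
  ring : ∀ (A D₋ D₊ : ℤ) → A ℤ.+ (D₋ ℤ.- D₊) ℤ.+ ℤ.0ℤ ≡ A ℤ.+ ℤ.0ℤ ℤ.+ ((D₋ ℤ.+ ℤ.0ℤ) ℤ.- (D₊ ℤ.+ ℤ.0ℤ))
  ring = solve-∀
when-interchange false false _ _ _ _ _ _ _ = refl

module _ {m : ℕ} where
  infix 4 _≈ₚ_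
  _≈ₚ_ : H m → H m → Set
  h ≈ₚ h' = ∀ u → IsPerm u → h u ≗ h' u

  ≈ₚ-trans : ∀ {h h' h''} → h ≈ₚ h' → h' ≈ₚ h'' → h ≈ₚ h''
  ≈ₚ-trans h≈h' h'≈h'' u u-perm k = trans (h≈h' u u-perm k) (h'≈h'' u u-perm k)

  ≈ₚ-sym : ∀ {h h'} → h ≈ₚ h' → h' ≈ₚ h
  ≈ₚ-sym h≈h' u u-perm k = sym (h≈h' u u-perm k)

  -- multiplication by v - v⁻¹, where v = q^{1/2}
  δ : H m → H m
  δ h u k = h u (k ℤ.- ℤ.1ℤ) ℤ.- h u (k ℤ.+ ℤ.1ℤ)

  -- Multiplication by a generator T̃_s acting on 𝔖_n by f: Ts i is Tmul (lmul i) by definition,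
  -- and Tr j is right multiplication by T̃_{s_j}.
  Tmul : (Arr (suc m) → Arr (suc m)) → H m → H m
  Tmul f h u k = h (f u) k ℤ.+ when (descends f u) (δ h u k)

  Tr : Fin m → H m → H m
  Tr j = Tmul (λ u → rmul u j)

  Tmul-cong : ∀ {f} → (∀ u → IsPerm u → IsPerm (f u)) → ∀ {h h'} → h ≈ₚ h' → Tmul f h ≈ₚ Tmul f h'
  Tmul-cong {f} f-perm h≈h' u u-perm k =
    cong₂ ℤ._+_ (h≈h' (f u) (f-perm u u-perm) k)
                (cong (when (descends f u)) (cong₂ ℤ._-_ (h≈h' u u-perm (k ℤ.- ℤ.1ℤ)) (h≈h' u u-perm (k ℤ.+ ℤ.1ℤ))))

  Ts-cong : ∀ i {h h'} → h ≈ₚ h' → Ts i h ≈ₚ Ts i h'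
  Ts-cong i = Tmul-cong (lmul-perm i)

  Tr-cong : ∀ j {h h'} → h ≈ₚ h' → Tr j h ≈ₚ Tr j h'
  Tr-cong j = Tmul-cong (λ u → rmul-perm u j)

  T-diagonal : ∀ (x : Arr (suc m)) k → T x x k ≡ (if does (k ℤ.≟ ℤ.0ℤ) then ℤ.1ℤ else ℤ.0ℤ)
  T-diagonal x k rewrite dec-true (VP.≡-dec _≟_ x x) refl = refl

  T-off-diagonal : ∀ {x u : Arr (suc m)} k → u ≢ x → T x u k ≡ ℤ.0ℤ
  T-off-diagonal {x} {u} k u≢x rewrite dec-false (VP.≡-dec _≟_ u x) u≢x = refl

  δ-T-off-diagonal : ∀ {x u : Arr (suc m)} → u ≢ x → ∀ k → δ (T x) u k ≡ ℤ.0ℤ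
  δ-T-off-diagonal u≢x k = cong₂ ℤ._-_ (T-off-diagonal (k ℤ.- ℤ.1ℤ) u≢x) (T-off-diagonal (k ℤ.+ ℤ.1ℤ) u≢x)

  Tmul-T-ascent : ∀ {f} → Involutive _≡_ f → ∀ v → inv (f v) ≡ suc (inv v) → ∀ u → Tmul f (T v) u ≗ T (f v) u
  Tmul-T-ascent {f} f-inv v up u k = by-cases (VP.≡-dec _≟_ u (f v)) (VP.≡-dec _≟_ u v)
    where
    open ≡-Reasoning
    fv≢v : f v ≢ v
    fv≢v fv≡v = NP.1+n≢n (trans (sym up) (cong inv fv≡v))
    by-cases : Dec (u ≡ f v) → Dec (u ≡ v) → Tmul f (T v) u k ≡ T (f v) u k
    by-cases (yes u≡fv) _ rewrite u≡fv = begin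
      T v (f (f v)) k ℤ.+ when (descends f (f v)) (δ (T v) (f v) k)
        ≡⟨ cong₂ (λ w b → T v w k ℤ.+ when b (δ (T v) (f v) k)) (f-inv v)
                 (descends-if-descent {f = f} {u = f v} (trans up (cong (suc ∘ inv) (sym (f-inv v))))) ⟩
      T v v k ℤ.+ δ (T v) (f v) k
        ≡⟨ cong (λ z → T v v k ℤ.+ z) (δ-T-off-diagonal fv≢v k) ⟩
      T v v k ℤ.+ ℤ.0ℤ
        ≡⟨ trans (ZP.+-identityʳ _) (trans (T-diagonal v k) (sym (T-diagonal (f v) k))) ⟩
      T (f v) (f v) k ∎
    by-cases (no u≢fv) (yes u≡v) rewrite u≡v =
      trans (cong₂ ℤ._+_ (T-off-diagonal k fv≢v) (cong (λ b → when b (δ (T v) v k)) (descends-if-ascent {f = f} {u = v} up)))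
            (sym (T-off-diagonal k (fv≢v ∘ sym)))
    by-cases (no u≢fv) (no u≢v) =
      trans (cong₂ ℤ._+_ (T-off-diagonal k (λ fu≡v → u≢fv (trans (sym (f-inv u)) (cong f fu≡v))))
                         (trans (cong (when (descends f u)) (δ-T-off-diagonal u≢v k)) (when-0 (descends f u))))
            (sym (T-off-diagonal k u≢fv))

  -- Tmul f (Tmul g h) u k unfolds to Tmul²-coefficient h u (g (f u)) (f u) (g u) k.
  Tmul²-coefficient : H m → (u w a x : Arr (suc m)) → ℤ → ℤ
  Tmul²-coefficient h u w a x k =
    h w k ℤ.+ when (does (inv w ℕ.<? inv a)) (δ h a k)
          ℤ.+ when (does (inv a ℕ.<? inv u))
                   ((h x (k ℤ.- ℤ.1ℤ) ℤ.+ when (does (inv x ℕ.<? inv u)) (δ h u (k ℤ.- ℤ.1ℤ))) ℤ.-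
                    (h x (k ℤ.+ ℤ.1ℤ) ℤ.+ when (does (inv x ℕ.<? inv u)) (δ h u (k ℤ.+ ℤ.1ℤ))))

  Tmul-comm : ∀ {f g} h u → f (g u) ≡ g (f u) →
              g u ≡ f u ⊎ (descends g (f u) ≡ descends g u × descends f (g u) ≡ descends f u) →
              Tmul f (Tmul g h) u ≗ Tmul g (Tmul f h) u
  Tmul-comm {f} {g} h u fg≡gf (inj₁ gu≡fu) k = begin
    Tmul²-coefficient h u (g (f u)) (f u) (g u) k  ≡⟨ cong (λ x → Tmul²-coefficient h u (g (f u)) (f u) x k) gu≡fu ⟩
    Tmul²-coefficient h u (g (f u)) (f u) (f u) k  ≡⟨ cong₂ (λ w a → Tmul²-coefficient h u w a (f u) k) fg≡gf gu≡fu ⟨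
    Tmul²-coefficient h u (f (g u)) (g u) (f u) k  ∎
    where open ≡-Reasoning
  Tmul-comm {f} {g} h u fg≡gf (inj₂ (dgf≡dgu , dfg≡dfu)) k = begin
    A ℤ.+ when (descends g (f u)) (D₋ ℤ.- D₊) ℤ.+ when dfu ((X₋ ℤ.+ when dgu Y₋) ℤ.- (X₊ ℤ.+ when dgu Y₊))
      ≡⟨ cong (λ c → A ℤ.+ when c (D₋ ℤ.- D₊) ℤ.+ when dfu ((X₋ ℤ.+ when dgu Y₋) ℤ.- (X₊ ℤ.+ when dgu Y₊))) dgf≡dgu ⟩
    A ℤ.+ when dgu (D₋ ℤ.- D₊) ℤ.+ when dfu ((X₋ ℤ.+ when dgu Y₋) ℤ.- (X₊ ℤ.+ when dgu Y₊))
      ≡⟨ when-interchange dfu dgu A D₋ D₊ X₋ X₊ Y₋ Y₊ ⟩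
    A ℤ.+ when dfu (X₋ ℤ.- X₊) ℤ.+ when dgu ((D₋ ℤ.+ when dfu Y₋) ℤ.- (D₊ ℤ.+ when dfu Y₊))
      ≡⟨ cong₂ (λ a c → a ℤ.+ when c (X₋ ℤ.- X₊) ℤ.+ when dgu ((D₋ ℤ.+ when dfu Y₋) ℤ.- (D₊ ℤ.+ when dfu Y₊)))
               (cong (λ w → h w k) fg≡gf) dfg≡dfu ⟨
    h (f (g u)) k ℤ.+ when (descends f (g u)) (X₋ ℤ.- X₊) ℤ.+ when dgu ((D₋ ℤ.+ when dfu Y₋) ℤ.- (D₊ ℤ.+ when dfu Y₊))
      ∎
    where
    open ≡-Reasoning
    dfu = descends f u
    dgu = descends g u
    A  = h (g (f u)) k
    D₋ = h (f u) (k ℤ.- ℤ.1ℤ)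
    D₊ = h (f u) (k ℤ.+ ℤ.1ℤ)
    X₋ = h (g u) (k ℤ.- ℤ.1ℤ)
    X₊ = h (g u) (k ℤ.+ ℤ.1ℤ)
    Y₋ = δ h u (k ℤ.- ℤ.1ℤ)
    Y₊ = δ h u (k ℤ.+ ℤ.1ℤ)

  fixed-or-descents-preserved : ∀ i j {u : Arr (suc m)} → IsPerm u →
    rmul u j ≡ lmul i u ⊎
    (descends (λ w → rmul w j) (lmul i u) ≡ descends (λ w → rmul w j) u ×
     descends (lmul i) (rmul u j) ≡ descends (lmul i) u)
  fixed-or-descents-preserved i j {u} u-perm with IsSwapPair? i (lookup u (lo j)) (lookup u (hi j))
  ... | yes pair = inj₁ (trans (sym (lmul-involutive i (rmul u j))) (cong (lmul i) (lmul-rmul-fixed i j {u} u-perm pair)))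
  ... | no not-pair = inj₂ (right-descent-preserved , left-descent-preserved)
    where
    right-descent-preserved : descends (λ w → rmul w j) (lmul i u) ≡ descends (λ w → rmul w j) u
    right-descent-preserved = begin
      descends (λ w → rmul w j) (lmul i u)
        ≡⟨ descends-rmul (lmul i u) j (lmul-perm i u u-perm) ⟩
      does (lookup (lmul i u) (hi j) <? lookup (lmul i u) (lo j))
        ≡⟨ cong₂ (λ a b → does (a <? b)) (lookup-lmul i u (hi j)) (lookup-lmul i u (lo j)) ⟩
      does (swap i (lookup u (hi j)) <? swap i (lookup u (lo j)))
        ≡⟨ swap-preserves-<? i _ _ (not-pair ∘ IsSwapPair-sym i) ⟩
      does (lookup u (hi j) <? lookup u (lo j))
        ≡⟨ descends-rmul u j u-perm ⟨
      descends (λ w → rmul w j) u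
        ∎
      where open ≡-Reasoning
    left-descent-preserved : descends (lmul i) (rmul u j) ≡ descends (lmul i) u
    left-descent-preserved with p , up ← u-perm (lo i) | q , uq ← u-perm (hi i) = begin
      descends (lmul i) (rmul u j)      ≡⟨ descends-lmul i (rmul u j) (rmul-perm u j u-perm) {swap j p} {swap j q}
                                             (trans (lookup-rmul-swap u j p) up) (trans (lookup-rmul-swap u j q) uq) ⟩
      does (swap j q <? swap j p)       ≡⟨ swap-preserves-<? j q p not-pair′ ⟩
      does (q <? p)                     ≡⟨ descends-lmul i u u-perm up uq ⟨
      descends (lmul i) u               ∎
      where
      open ≡-Reasoning
      not-pair′ : ¬ IsSwapPair j q p
      not-pair′ (inj₁ (refl , refl)) = not-pair (inj₂ (uq , up))
      not-pair′ (inj₂ (refl , refl)) = not-pair (inj₁ (up , uq))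

  Ts-Tr-comm : ∀ i j h → Ts i (Tr j h) ≈ₚ Tr j (Ts i h)
  Ts-Tr-comm i j h u u-perm =
    Tmul-comm {f = lmul i} {g = λ w → rmul w j} h u (lmul-rmul-comm i u j) (fixed-or-descents-preserved i j u-perm)

  Trw : List (Fin m) → H m → H m
  Trw []      h = h
  Trw (j ∷ τ) h = Tr j (Trw τ h)

  actW-cong : ∀ (ws : List (Fin m)) {h h'} → h ≈ₚ h' → actW ws h ≈ₚ actW ws h'
  actW-cong []       h≈h' = h≈h'
  actW-cong (i ∷ ws) h≈h' = Ts-cong i (actW-cong ws h≈h')

  Trw-cong : ∀ (τ : List (Fin m)) {h h'} → h ≈ₚ h' → Trw τ h ≈ₚ Trw τ h'
  Trw-cong []      h≈h' = h≈h'
  Trw-cong (j ∷ τ) h≈h' = Tr-cong j (Trw-cong τ h≈h')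

  Ts-Trw-comm : ∀ (i : Fin m) τ h → Ts i (Trw τ h) ≈ₚ Trw τ (Ts i h)
  Ts-Trw-comm i []      h u _ k = refl
  Ts-Trw-comm i (j ∷ τ) h = ≈ₚ-trans (Ts-Tr-comm i j (Trw τ h)) (Tr-cong j (Ts-Trw-comm i τ h))

  actW-Trw-comm : ∀ (ws : List (Fin m)) τ h → actW ws (Trw τ h) ≈ₚ Trw τ (actW ws h)
  actW-Trw-comm []       τ h u _ k = refl
  actW-Trw-comm (i ∷ ws) τ h = ≈ₚ-trans (Ts-cong i (actW-Trw-comm ws τ h)) (Ts-Trw-comm i τ (actW ws h))

  e : Arr (suc m)
  e = Vec.allFin (suc m)

  inv-e : inv e ≡ 0
  inv-e = trans (inv≡∑∑inversion e)
                (trans (sum-cong-≗ λ a → trans (sum-cong-≗ (no-inversion a)) (sum-replicate-zero (suc m)))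
                       (sum-replicate-zero (suc m)))
    where
    no-inversion : ∀ a b → inversion e a b ≡ 0
    no-inversion a b with a <? b
    ... | yes a<b = inversion-no {u = e} {a} {b}
                      (subst₂ (λ x y → ¬ x F.< y) (sym (VP.lookup-allFin b)) (sym (VP.lookup-allFin a)) (NP.<-asym a<b))
    ... | no  a≮b = inversion-unordered {u = e} {a} {b} a≮b

  inv-eval-≤ : ∀ (ws : List (Fin m)) → inv (eval ws) ℕ.≤ List.length ws
  inv-eval-≤ []       = NP.≤-reflexive inv-e
  inv-eval-≤ (i ∷ ws) = NP.≤-trans (inv-lmul-≤ i (eval ws) (eval-perm ws)) (s≤s (inv-eval-≤ ws))

  Reduced-tail : ∀ {i : Fin m} {ws} {w : Arr (suc m)} → Reduced (i ∷ ws) w →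
                 Reduced ws (eval ws) × inv (lmul i (eval ws)) ≡ suc (inv (eval ws))
  Reduced-tail {i} {ws} (refl , length≡) = (refl , length-ws≡) , trans (sym length≡) (cong suc length-ws≡)
    where
    length-ws≡ : List.length ws ≡ inv (eval ws)
    length-ws≡ = NP.≤-antisym (NP.≤-pred (NP.≤-trans (NP.≤-reflexive length≡) (inv-lmul-≤ i (eval ws) (eval-perm ws))))
                              (inv-eval-≤ ws)

  actW-T-e : ∀ {ws} {w : Arr (suc m)} → Reduced ws w → actW ws (T e) ≈ₚ T w
  actW-T-e {[]}     (refl , _) u _ k = refl
  actW-T-e {i ∷ ws} red@(refl , _) =
    ≈ₚ-trans (Ts-cong i (actW-T-e {ws} (proj₁ tail)))
             (λ u _ → Tmul-T-ascent {f = lmul i} (lmul-involutive i) (eval ws) (proj₂ tail) u)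
    where
    tail : Reduced ws (eval ws) × inv (lmul i (eval ws)) ≡ suc (inv (eval ws))
    tail = Reduced-tail {ws = ws} red

  ascending⇒e : ∀ {x : Arr (suc m)} → (∀ j → lookup x (lo j) F.< lookup x (hi j)) → x ≡ e
  ascending⇒e {x} ascending = lookup-ext λ r → trans (FP.≤-antisym (below r) (above r)) (sym (VP.lookup-allFin r))
    where
    above : ∀ r → r F.≤ lookup x r
    above = <-weakInduction (λ r → r F.≤ lookup x r) z≤n
      (λ j lo≤ → NP.≤-trans (s≤s (NP.≤-trans (NP.≤-reflexive (sym (toℕ-lo j))) lo≤)) (ascending j))
    below : ∀ r → lookup x r F.≤ r
    below = >-weakInduction (λ r → lookup x r F.≤ r) (FP.≤fromℕ _)
      (λ j ≤hi → NP.≤-trans (NP.≤-pred (NP.≤-trans (ascending j) ≤hi)) (NP.≤-reflexive (sym (toℕ-lo j))))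

  T-as-Trw : ∀ (x : Arr (suc m)) → IsPerm x → ∃ λ τ → T x ≈ₚ Trw τ (T e)
  T-as-Trw x x-perm = go x x-perm (<-wellFounded (inv x))
    where
    go : ∀ x → IsPerm x → Acc ℕ._<_ (inv x) → ∃ λ τ → T x ≈ₚ Trw τ (T e)
    go x x-perm (acc rec) with FP.any? (λ j → lookup x (hi j) <? lookup x (lo j))
    ... | yes (j , descent) = extend (go (rmul x j) (rmul-perm x j x-perm) (rec (NP.≤-reflexive (sym down))))
      where
      down : inv x ≡ suc (inv (rmul x j))
      down = inv-rmul-descent x j descent
      step : T x ≈ₚ Tr j (T (rmul x j))
      step u _ k = sym (trans (Tmul-T-ascent {f = λ w → rmul w j} (rmul-involutive j) (rmul x j)
                                             (trans (cong inv (rmul-involutive j x)) down) u k)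
                              (cong (λ y → T y u k) (rmul-involutive j x)))
      extend : (∃ λ τ → T (rmul x j) ≈ₚ Trw τ (T e)) → ∃ λ τ → T x ≈ₚ Trw τ (T e)
      extend (τ , x'≈) = j ∷ τ , ≈ₚ-trans step (Tr-cong j x'≈)
    ... | no no-descent = [] , λ u _ k → cong (λ y → T y u k) (ascending⇒e ascending)
      where
      ascending : ∀ j → lookup x (lo j) F.< lookup x (hi j)
      ascending j with NP.<-cmp (toℕ (lookup x (lo j))) (toℕ (lookup x (hi j)))
      ... | tri< lt _ _ = lt
      ... | tri≈ _ eq _ = ⊥-elim (lo≢hi j (IsPerm⇒injective {u = x} x-perm (toℕ-injective eq)))
      ... | tri> _ _ gt = ⊥-elim (no-descent (j , gt))

  actW-reduced-T : ∀ {x : Arr (suc m)} → IsPerm x → ∀ {σ σ'} {w : Arr (suc m)} → Reduced σ w → Reduced σ' w →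
                   actW σ (T x) ≈ₚ actW σ' (T x)
  actW-reduced-T {x} x-perm {σ} {σ'} red red' with τ , x≈ ← T-as-Trw x x-perm =
    ≈ₚ-trans (via {σ} red) (≈ₚ-sym (via {σ'} red'))
    where
    via : ∀ {σ} {w : Arr (suc m)} → Reduced σ w → actW σ (T x) ≈ₚ Trw τ (T w)
    via {σ} red = ≈ₚ-trans (actW-cong σ x≈) (≈ₚ-trans (actW-Trw-comm σ τ (T e)) (Trw-cong τ (actW-T-e {σ} red)))

-- Words avoiding a generator

module _ {m : ℕ} (s : Fin m) where
  low? : Fin (suc m) → Bool
  low? r = does (toℕ r ℕ.≤? toℕ s)

  low?-lo : low? (lo s) ≡ true
  low?-lo = dec-true (toℕ (lo s) ℕ.≤? toℕ s) (NP.≤-reflexive (toℕ-lo s))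

  low?-hi : low? (hi s) ≡ false
  low?-hi = dec-false (toℕ (hi s) ℕ.≤? toℕ s) (NP.<⇒≱ (NP.n<1+n (toℕ s)))

  low?-step : ∀ {i} → i ≢ s → low? (lo i) ≡ low? (hi i)
  low?-step {i} i≢s rewrite toℕ-lo i = by-cases (toℕ i ℕ.≤? toℕ s)
    where
    by-cases : Dec (toℕ i ℕ.≤ toℕ s) → does (toℕ i ℕ.≤? toℕ s) ≡ does (suc (toℕ i) ℕ.≤? toℕ s)
    by-cases (yes i≤s) = trans (dec-true (toℕ i ℕ.≤? toℕ s) i≤s)
                               (sym (dec-true (suc (toℕ i) ℕ.≤? toℕ s) (NP.≤∧≢⇒< i≤s (i≢s ∘ toℕ-injective))))
    by-cases (no i≰s)  = trans (dec-false (toℕ i ℕ.≤? toℕ s) i≰s)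
                               (sym (dec-false (suc (toℕ i) ℕ.≤? toℕ s) (i≰s ∘ NP.<⇒≤)))

  low?-swap : ∀ {i} → i ≢ s → ∀ r → low? (swap i r) ≡ low? r
  low?-swap {i} i≢s r with swapCase i r
  ... | at-lo refl = trans (cong low? (swap-lo i)) (sym (low?-step i≢s))
  ... | at-hi refl = trans (cong low? (swap-hi i)) (low?-step i≢s)
  ... | apart r≢lo r≢hi = cong low? (swap-other i r≢lo r≢hi)

  low?-apply : ∀ g → s ∉ g → ∀ r → low? (apply g r) ≡ low? r
  low?-apply []      s∉g r = refl
  low?-apply (i ∷ g) s∉g r = trans (low?-swap (s∉g ∘ here ∘ sym) (apply g r)) (low?-apply g (s∉g ∘ there) r)

  low?⇒≤ : ∀ {r} → low? r ≡ true → toℕ r ℕ.≤ toℕ s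
  low?⇒≤ {r} low = NP.≤ᵇ⇒≤ (toℕ r) (toℕ s) (subst Bool.T (sym low) _)

  ¬low?⇒> : ∀ {r} → low? r ≡ false → toℕ s ℕ.< toℕ r
  ¬low?⇒> {r} high = NP.≰⇒> (λ r≤s → subst Bool.T high (NP.≤⇒≤ᵇ r≤s))

  Reduced-snoc : ∀ {ρ} {w : Arr (suc m)} → Reduced ρ w → s ∉ ρ → Reduced (ρ ++ s ∷ []) (rmul w s)
  Reduced-snoc {ρ} (refl , length≡) s∉ρ = eval-snoc , (begin
    List.length (ρ ++ s ∷ [])    ≡⟨ LP.length-++ ρ ⟩
    List.length ρ + 1            ≡⟨ NP.+-comm (List.length ρ) 1 ⟩
    suc (List.length ρ)          ≡⟨ cong suc length≡ ⟩
    suc (inv (eval ρ))           ≡⟨ inv-rmul-ascent (eval ρ) s lo<hi′ ⟨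
    inv (rmul (eval ρ) s)        ∎)
    where
    open ≡-Reasoning
    eval-snoc : eval (ρ ++ s ∷ []) ≡ rmul (eval ρ) s
    eval-snoc = lookup-ext λ r → trans (lookup-eval (ρ ++ s ∷ []) r)
      (trans (apply-++ ρ (s ∷ []) r) (sym (trans (lookup-rmul (eval ρ) s r) (lookup-eval ρ (swap s r)))))
    lo-stays-low : low? (lookup (eval ρ) (lo s)) ≡ true
    lo-stays-low = trans (cong low? (lookup-eval ρ (lo s))) (trans (low?-apply ρ s∉ρ (lo s)) low?-lo)
    hi-stays-high : low? (lookup (eval ρ) (hi s)) ≡ false
    hi-stays-high = trans (cong low? (lookup-eval ρ (hi s))) (trans (low?-apply ρ s∉ρ (hi s)) low?-hi)
    lo<hi′ : lookup (eval ρ) (lo s) F.< lookup (eval ρ) (hi s)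
    lo<hi′ = NP.≤-<-trans (low?⇒≤ lo-stays-low) (¬low?⇒> hi-stays-high)

  actW-local : ∀ ρ → s ∉ ρ → ∀ {h h' : H m} u → (∀ g → s ∉ g → h (lmulW g u) ≗ h' (lmulW g u)) →
               actW ρ h u ≗ actW ρ h' u
  actW-local []      s∉ρ u agree = agree [] λ ()
  actW-local (i ∷ ρ) s∉ρ {h} {h'} u agree k =
    cong₂ ℤ._+_ (actW-local ρ (s∉ρ ∘ there) (lmul i u) agree′ k)
                (cong (when (descends (lmul i) u))
                      (cong₂ ℤ._-_ (actW-local ρ (s∉ρ ∘ there) u agree (k ℤ.- ℤ.1ℤ))
                                   (actW-local ρ (s∉ρ ∘ there) u agree (k ℤ.+ ℤ.1ℤ))))
    where
    s∉g++i : ∀ g → s ∉ g → s ∉ g ++ i ∷ []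
    s∉g++i g s∉g s∈ with ∈-++⁻ g s∈
    ... | inj₁ s∈g         = s∉g s∈g
    ... | inj₂ (here s≡i) = s∉ρ (here s≡i)
    agree′ : ∀ g → s ∉ g → h (lmulW g (lmul i u)) ≗ h' (lmulW g (lmul i u))
    agree′ g s∉g = subst (λ w → h w ≗ h' w) (LP.foldr-++ lmul u g (i ∷ [])) (agree (g ++ i ∷ []) (s∉g++i g s∉g))

  countLow : (Fin (suc m) → ℕ) → ℕ → ℕ
  countLow χ c = sum (λ r → if low? r ∧ does (χ r ℕ.≟ c) then 1 else 0)

  countLow-apply : ∀ g → s ∉ g → ∀ χ c → countLow (χ ∘ apply g) c ≡ countLow χ c
  countLow-apply []      s∉g χ c = refl
  countLow-apply (i ∷ g) s∉g χ c = begin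
    countLow (χ ∘ swap i ∘ apply g) c
      ≡⟨ countLow-apply g (s∉g ∘ there) (χ ∘ swap i) c ⟩
    sum (λ r → if low? r ∧ does (χ (swap i r) ℕ.≟ c) then 1 else 0)
      ≡⟨ sum-cong-≗ (λ r → cong (λ b → if b ∧ does (χ (swap i r) ℕ.≟ c) then 1 else 0)
                                (sym (low?-swap (s∉g ∘ here ∘ sym) r))) ⟩
    sum (λ r → if low? (swap i r) ∧ does (χ (swap i r) ℕ.≟ c) then 1 else 0)
      ≡⟨ sum-swap i (λ r → if low? r ∧ does (χ r ℕ.≟ c) then 1 else 0) ⟩
    countLow χ c
      ∎
    where open ≡-Reasoning

  label-lo≡hi : ∀ (ψ : Fin (suc m) → ℕ) g → s ∉ g → (∀ r → ψ (swap s (apply g r)) ≡ ψ r) → ψ (lo s) ≡ ψ (hi s)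
  label-lo≡hi ψ g s∉g invariant = NP.≡ᵇ⇒≡ (ψ (lo s)) c (subst Bool.T (sym (indicator≡1 lo-counted)) _)
    where
    c = ψ (hi s)
    counted : (Fin (suc m) → ℕ) → Fin (suc m) → ℕ
    counted χ r = if low? r ∧ does (χ r ℕ.≟ c) then 1 else 0
    same-count : countLow ψ c ≡ countLow (ψ ∘ swap s) c
    same-count = trans (sum-cong-≗ λ r → cong (λ n → if low? r ∧ does (n ℕ.≟ c) then 1 else 0) (sym (invariant r)))
                       (countLow-apply g s∉g (ψ ∘ swap s) c)
    agree : ∀ r → r ≢ lo s → counted ψ r ≡ counted (ψ ∘ swap s) r
    agree r r≢lo with swapCase s r
    ... | at-lo r≡lo = ⊥-elim (r≢lo r≡lo)
    ... | at-hi refl = trans (cong (λ b → if b ∧ does (ψ (hi s) ℕ.≟ c) then 1 else 0) low?-hi)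
                             (sym (cong (λ b → if b ∧ does (ψ (swap s (hi s)) ℕ.≟ c) then 1 else 0) low?-hi))
    ... | apart r≢lo′ r≢hi = cong (λ n → if low? r ∧ does (ψ n ℕ.≟ c) then 1 else 0) (sym (swap-other s r≢lo′ r≢hi))
    lo-counted : (if does (ψ (lo s) ℕ.≟ c) then 1 else 0) ≡ 1
    lo-counted = begin
      (if does (ψ (lo s) ℕ.≟ c) then 1 else 0)
        ≡⟨ cong (λ b → if b ∧ does (ψ (lo s) ℕ.≟ c) then 1 else 0) low?-lo ⟨
      counted ψ (lo s)
        ≡⟨ sum-agree-at (lo s) agree same-count ⟩
      counted (ψ ∘ swap s) (lo s)
        ≡⟨ cong₂ (λ b n → if b ∧ does (ψ n ℕ.≟ c) then 1 else 0) low?-lo (swap-lo s) ⟩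
      (if does (c ℕ.≟ c) then 1 else 0)
        ≡⟨ cong (λ b → if b then 1 else 0) (dec-true (c ℕ.≟ c) refl) ⟩
      1 ∎
      where open ≡-Reasoning
    indicator≡1 : ∀ {b} → (if b then 1 else 0) ≡ 1 → b ≡ true
    indicator≡1 {true} _ = refl

-- Cosets of 𝔖_J

-- The number of generators below position r that are not in J; the 𝔖_J-orbits of positions are its level sets.
block : ∀ {m} → Subset m → Fin (suc m) → ℕ
block J       F.zero    = 0
block (b ∷ J) (F.suc r) = (if b then 0 else 1) + block J r

block-hi : ∀ {m} (J : Subset m) j → block J (hi j) ≡ block J (lo j) + (if lookup J j then 0 else 1)
block-hi (b ∷ J) F.zero    = NP.+-identityʳ _
block-hi (b ∷ J) (F.suc j) =
  trans (cong ((if b then 0 else 1) +_) (block-hi J j)) (sym (NP.+-assoc (if b then 0 else 1) (block J (lo j)) _))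

module _ {m : ℕ} where

  block-hi-∈ : ∀ (J : Subset m) {j} → j ∈ₛ J → block J (hi j) ≡ block J (lo j)
  block-hi-∈ J {j} j∈J = trans (block-hi J j) (trans (cong (λ b → block J (lo j) + (if b then 0 else 1)) (VP.[]=⇒lookup j∈J))
                                                     (NP.+-identityʳ _))

  block-swap : ∀ (J : Subset m) {j} → j ∈ₛ J → ∀ r → block J (swap j r) ≡ block J r
  block-swap J {j} j∈J r with swapCase j r
  ... | at-lo refl = trans (cong (block J) (swap-lo j)) (block-hi-∈ J j∈J)
  ... | at-hi refl = trans (cong (block J) (swap-hi j)) (sym (block-hi-∈ J j∈J))
  ... | apart r≢lo r≢hi = cong (block J) (swap-other j r≢lo r≢hi)

  block-apply : ∀ (J : Subset m) {ws : List (Fin m)} → All (_∈ₛ J) ws → ∀ r → block J (apply ws r) ≡ block J r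
  block-apply J []             r = refl
  block-apply J {i ∷ ws} (i∈J ∷ ws∈J) r = trans (block-swap J i∈J (apply ws r)) (block-apply J ws∈J r)

block-mono : ∀ {m} (J : Subset m) {r r'} → r F.≤ r' → block J r ℕ.≤ block J r'
block-mono J       {F.zero}  {_}        _          = z≤n
block-mono (b ∷ J) {F.suc r} {F.suc r'} (s≤s r≤r') = NP.+-monoʳ-≤ (if b then 0 else 1) (block-mono J r≤r')

module _ {m : ℕ} (J : Subset m) where
  block-flat⇒∈ : ∀ {p q} k → p F.≤ lo k → hi k F.≤ q → block J p ≡ block J q → k ∈ₛ J
  block-flat⇒∈ {p} {q} k p≤lo hi≤q p≡q =
    VP.lookup⇒[]= k J (indicator≡0 (NP.n≤0⇒n≡0 (NP.+-cancelˡ-≤ (block J (lo k)) _ 0 step≤0)))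
    where
    step≤0 : block J (lo k) + (if lookup J k then 0 else 1) ℕ.≤ block J (lo k) + 0
    step≤0 = begin
      block J (lo k) + (if lookup J k then 0 else 1)  ≡⟨ block-hi J k ⟨
      block J (hi k)                                  ≤⟨ block-mono J hi≤q ⟩
      block J q                                       ≡⟨ p≡q ⟨
      block J p                                       ≤⟨ block-mono J p≤lo ⟩
      block J (lo k)                                  ≡⟨ NP.+-identityʳ _ ⟨
      block J (lo k) + 0                              ∎
      where open NP.≤-Reasoning
    indicator≡0 : ∀ {b} → (if b then 0 else 1) ≡ 0 → b ≡ true
    indicator≡0 {true} _ = refl

module _ {n : ℕ} where
  transpose-first : ∀ (a b : Fin n) → transpose a b a ≡ b
  transpose-first a b rewrite dec-true (a ≟ a) refl = refl

  transpose-second : ∀ {a b : Fin n} → b ≢ a → transpose a b b ≡ a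
  transpose-second {a} {b} b≢a rewrite dec-false (b ≟ a) b≢a | dec-true (b ≟ b) refl = refl

  transpose-other : ∀ {a b r : Fin n} → r ≢ a → r ≢ b → transpose a b r ≡ r
  transpose-other {a} {b} {r} r≢a r≢b rewrite dec-false (r ≟ a) r≢a | dec-false (r ≟ b) r≢b = refl

  transpose-sym : ∀ {a b : Fin n} → a ≢ b → ∀ r → transpose a b r ≡ transpose b a r
  transpose-sym {a} {b} a≢b r = by-cases (r ≟ a) (r ≟ b)
    where
    by-cases : Dec (r ≡ a) → Dec (r ≡ b) → transpose a b r ≡ transpose b a r
    by-cases (yes refl) _          = trans (transpose-first r b) (sym (transpose-second a≢b))
    by-cases (no _)     (yes refl) = trans (transpose-second (a≢b ∘ sym)) (sym (transpose-first r a))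
    by-cases (no r≢a)   (no r≢b)   = trans (transpose-other r≢a r≢b) (sym (transpose-other r≢b r≢a))

module _ {m : ℕ} where
  swap≗transpose : ∀ (i : Fin m) r → swap i r ≡ transpose (lo i) (hi i) r
  swap≗transpose i r with swapCase i r
  ... | at-lo refl = trans (swap-lo i) (sym (transpose-first (lo i) (hi i)))
  ... | at-hi refl = trans (swap-hi i) (sym (transpose-second (lo≢hi i ∘ sym)))
  ... | apart r≢lo r≢hi = trans (swap-other i r≢lo r≢hi) (sym (transpose-other r≢lo r≢hi))

  swap-conjugates-transpose : ∀ (i : Fin m) a b r →
                              swap i (transpose a b (swap i r)) ≡ transpose (swap i a) (swap i b) r
  swap-conjugates-transpose i a b r = by-cases (swap i r ≟ a) (swap i r ≟ b)
    where
    r≡s : ∀ {c} → swap i r ≡ c → r ≡ swap i c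
    r≡s sr≡c = trans (sym (swap-involutive i r)) (cong (swap i) sr≡c)
    r≢s : ∀ {c} → swap i r ≢ c → r ≢ swap i c
    r≢s sr≢c r≡sc = sr≢c (trans (cong (swap i) r≡sc) (swap-involutive i _))
    by-cases : Dec (swap i r ≡ a) → Dec (swap i r ≡ b) →
               swap i (transpose a b (swap i r)) ≡ transpose (swap i a) (swap i b) r
    by-cases (yes sr≡a) _ =
      trans (cong (swap i) (trans (cong (transpose a b) sr≡a) (transpose-first a b)))
            (sym (trans (cong (λ x → transpose x (swap i b) r) (sym (r≡s sr≡a))) (transpose-first r (swap i b))))
    by-cases (no sr≢a) (yes sr≡b) =
      trans (cong (swap i) (trans (cong (transpose a b) sr≡b) (transpose-second b≢a)))
            (sym (trans (cong (transpose (swap i a) (swap i b)) (r≡s sr≡b)) (transpose-second (b≢a ∘ swap-injective))))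
      where
      b≢a : b ≢ a
      b≢a b≡a = sr≢a (trans sr≡b b≡a)
      swap-injective : swap i b ≡ swap i a → b ≡ a
      swap-injective sb≡sa = trans (sym (swap-involutive i b)) (trans (cong (swap i) sb≡sa) (swap-involutive i a))
    by-cases (no sr≢a) (no sr≢b) =
      trans (cong (swap i) (transpose-other sr≢a sr≢b))
            (trans (swap-involutive i r) (sym (transpose-other (r≢s sr≢a) (r≢s sr≢b))))

module _ {m : ℕ} (J : Subset m) where
  IsJWordFor : (Fin (suc m) → Fin (suc m)) → Set
  IsJWordFor t = ∃ λ ws → All (_∈ₛ J) ws × (∀ r → apply ws r ≡ t r)

  -- (p q) = s_k (p k) s_k with k + 1 = q, by induction on q
  transposition-word : ∀ q p → p F.< q → (∀ k → p F.≤ lo k → hi k F.≤ q → k ∈ₛ J) → IsJWordFor (transpose p q)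
  transposition-word = <-weakInduction Word-exists (λ p ()) step
    where
    Word-exists : Fin (suc m) → Set
    Word-exists q = ∀ p → p F.< q → (∀ k → p F.≤ lo k → hi k F.≤ q → k ∈ₛ J) → IsJWordFor (transpose p q)
    step : ∀ j → Word-exists (lo j) → Word-exists (hi j)
    step j IH p p<hi gaps∈J with p ≟ lo j
    ... | yes refl = j ∷ [] , gaps∈J j NP.≤-refl NP.≤-refl ∷ [] , swap≗transpose j
    ... | no p≢lo = conjugate (IH p p<lo (λ k p≤lo hi≤lo → gaps∈J k p≤lo (NP.≤-trans hi≤lo (NP.<⇒≤ (lo<hi j)))))
      where
      p<lo : p F.< lo j
      p<lo = NP.≤∧≢⇒< (subst (toℕ p ℕ.≤_) (sym (toℕ-lo j)) (NP.≤-pred p<hi)) (p≢lo ∘ toℕ-injective)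
      p≢hi : p ≢ hi j
      p≢hi p≡hi = NP.<-irrefl (cong toℕ p≡hi) p<hi
      j∈J : j ∈ₛ J
      j∈J = gaps∈J j (NP.<⇒≤ p<lo) NP.≤-refl
      conjugate : IsJWordFor (transpose p (lo j)) → IsJWordFor (transpose p (hi j))
      conjugate (ws , ws∈J , ws≗) = j ∷ ws ++ j ∷ [] , j∈J ∷ ++⁺ ws∈J (j∈J ∷ []) , λ r → begin
        swap j (apply (ws ++ j ∷ []) r)         ≡⟨ cong (swap j) (apply-++ ws (j ∷ []) r) ⟩
        swap j (apply ws (swap j r))            ≡⟨ cong (swap j) (ws≗ (swap j r)) ⟩
        swap j (transpose p (lo j) (swap j r))  ≡⟨ swap-conjugates-transpose j p (lo j) r ⟩
        transpose (swap j p) (swap j (lo j)) r  ≡⟨ cong₂ (λ a b → transpose a b r) (swap-other j p≢lo p≢hi) (swap-lo j) ⟩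
        transpose p (hi j) r                    ∎
        where open ≡-Reasoning

  same-block⇒word : ∀ {p q} → p ≢ q → block J p ≡ block J q → IsJWordFor (transpose p q)
  same-block⇒word {p} {q} p≢q same with NP.<-cmp (toℕ p) (toℕ q)
  ... | tri< p<q _ _ = transposition-word q p p<q (λ k p≤lo hi≤q → block-flat⇒∈ J k p≤lo hi≤q same)
  ... | tri≈ _ p≡q _ = ⊥-elim (p≢q (toℕ-injective p≡q))
  ... | tri> _ _ q<p
    with ws , ws∈J , ws≗ ← transposition-word p q q<p (λ k q≤lo hi≤p → block-flat⇒∈ J k q≤lo hi≤p (sym same)) =
    ws , ws∈J , λ r → trans (ws≗ r) (transpose-sym (p≢q ∘ sym) r)

  ∼-refl : ∀ (x : Arr (suc m)) → x ∼[ J ] x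
  ∼-refl x = [] , [] , sym (VP.map-lookup-allFin x)

  ∼⇒lookup : ∀ {u x : Arr (suc m)} → u ∼[ J ] x → ∃ λ ws → All (_∈ₛ J) ws × (∀ r → lookup x r ≡ lookup u (apply ws r))
  ∼⇒lookup {u} (ws , ws∈J , refl) =
    ws , ws∈J , λ r → trans (lookup-comp u (eval ws) r) (cong (lookup u) (lookup-eval ws r))

  ∼⇒IsPerm : ∀ {u x : Arr (suc m)} → IsPerm x → u ∼[ J ] x → IsPerm u
  ∼⇒IsPerm {u} {x} x-perm u∼x v with ws , _ , x≗ ← ∼⇒lookup {u} {x} u∼x | r , xr≡v ← x-perm v =
    apply ws r , trans (sym (x≗ r)) xr≡v

  swap-conjugates-transposition : ∀ {x : Arr (suc m)} → IsPerm x → ∀ {s p q} → lookup x p ≡ lo s → lookup x q ≡ hi s →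
                                  ∀ r → swap s (lookup x (transpose p q r)) ≡ lookup x r
  swap-conjugates-transposition {x} x-perm {s} {p} {q} xp xq r = by-cases (r ≟ p) (r ≟ q)
    where
    inj : ∀ {a b} → lookup x a ≡ lookup x b → a ≡ b
    inj = IsPerm⇒injective {u = x} x-perm
    by-cases : Dec (r ≡ p) → Dec (r ≡ q) → swap s (lookup x (transpose p q r)) ≡ lookup x r
    by-cases (yes refl) _ =
      trans (cong (swap s ∘ lookup x) (transpose-first r q)) (trans (cong (swap s) xq) (trans (swap-hi s) (sym xp)))
    by-cases (no r≢p) (yes refl) =
      trans (cong (swap s ∘ lookup x) (transpose-second r≢p)) (trans (cong (swap s) xp) (trans (swap-lo s) (sym xq)))
    by-cases (no r≢p) (no r≢q) = trans (cong (swap s ∘ lookup x) (transpose-other r≢p r≢q))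
      (swap-other s (λ xr≡lo → r≢p (inj (trans xr≡lo (sym xp)))) (λ xr≡hi → r≢q (inj (trans xr≡hi (sym xq)))))

  lmul-∼-if-same-block : ∀ {x : Arr (suc m)} → IsPerm x → ∀ {s p q} → lookup x p ≡ lo s → lookup x q ≡ hi s →
                         block J p ≡ block J q → lmul s x ∼[ J ] x
  lmul-∼-if-same-block {x} x-perm {s} {p} {q} xp xq same = conclude (same-block⇒word p≢q same)
    where
    open ≡-Reasoning
    p≢q : p ≢ q
    p≢q p≡q = lo≢hi s (trans (sym xp) (trans (cong (lookup x) p≡q) xq))
    conclude : IsJWordFor (transpose p q) → lmul s x ∼[ J ] x
    conclude (ws , ws∈J , ws≗) = ws , ws∈J , lookup-ext λ r → sym (begin
      lookup (comp (lmul s x) (eval ws)) r    ≡⟨ lookup-comp (lmul s x) (eval ws) r ⟩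
      lookup (lmul s x) (lookup (eval ws) r)  ≡⟨ cong (lookup (lmul s x)) (trans (lookup-eval ws r) (ws≗ r)) ⟩
      lookup (lmul s x) (transpose p q r)     ≡⟨ lookup-lmul s x (transpose p q r) ⟩
      swap s (lookup x (transpose p q r))     ≡⟨ swap-conjugates-transposition {x} x-perm xp xq r ⟩
      lookup x r                              ∎)

  module _ {x : Arr (suc m)} (x-perm : IsPerm x) where
    valueBlock : Fin (suc m) → ℕ
    valueBlock w = block J (proj₁ (x-perm w))

    valueBlock-x : ∀ r → valueBlock (lookup x r) ≡ block J r
    valueBlock-x r = cong (block J) (IsPerm⇒injective {u = x} x-perm (proj₂ (x-perm (lookup x r))))

    valueBlock-∼ : ∀ {u} → u ∼[ J ] x → ∀ r → valueBlock (lookup u r) ≡ block J r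
    valueBlock-∼ {u} u∼x r with ws , ws∈J , x≗u∘ws ← ∼⇒lookup {u} {x} u∼x = via-preimage (eval-perm ws r)
      where
      open ≡-Reasoning
      via-preimage : (∃ λ r₀ → lookup (eval ws) r₀ ≡ r) → valueBlock (lookup u r) ≡ block J r
      via-preimage (r₀ , ws-r₀) = begin
        valueBlock (lookup u r)                 ≡⟨ cong (valueBlock ∘ lookup u) ws·r₀≡r ⟨
        valueBlock (lookup u (apply ws r₀))     ≡⟨ cong valueBlock (x≗u∘ws r₀) ⟨
        valueBlock (lookup x r₀)                ≡⟨ valueBlock-x r₀ ⟩
        block J r₀                              ≡⟨ block-apply J ws∈J r₀ ⟨
        block J (apply ws r₀)                   ≡⟨ cong (block J) ws·r₀≡r ⟩
        block J r                               ∎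
        where
        ws·r₀≡r : apply ws r₀ ≡ r
        ws·r₀≡r = trans (sym (lookup-eval ws r₀)) ws-r₀

    valueBlock-invariant : ∀ {u} → u ∼[ J ] x → ∀ s g → lmul s (lmulW g u) ≡ x →
                           ∀ w → valueBlock (swap s (apply g w)) ≡ valueBlock w
    valueBlock-invariant {u} u∼x s g sgu≡x w with r , ur≡w ← ∼⇒IsPerm {u} {x} x-perm u∼x w = begin
      valueBlock (swap s (apply g w))               ≡⟨ cong (valueBlock ∘ swap s ∘ apply g) ur≡w ⟨
      valueBlock (swap s (apply g (lookup u r)))    ≡⟨ cong (valueBlock ∘ swap s) (lookup-lmulW g u r) ⟨
      valueBlock (swap s (lookup (lmulW g u) r))    ≡⟨ cong valueBlock (lookup-lmul s (lmulW g u) r) ⟨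
      valueBlock (lookup (lmul s (lmulW g u)) r)    ≡⟨ cong (λ y → valueBlock (lookup y r)) sgu≡x ⟩
      valueBlock (lookup x r)                       ≡⟨ trans (valueBlock-x r) (sym (valueBlock-∼ {u} u∼x r)) ⟩
      valueBlock (lookup u r)                       ≡⟨ cong valueBlock ur≡w ⟩
      valueBlock w                                  ∎
      where open ≡-Reasoning

    sgu≡x⇒gu∼x : ∀ {u} → u ∼[ J ] x → ∀ s g → s ∉ g → lmul s (lmulW g u) ≡ x → lmulW g u ∼[ J ] x
    sgu≡x⇒gu∼x u∼x s g s∉g sgu≡x =
      subst (_∼[ J ] x) (trans (cong (lmul s) (sym sgu≡x)) (lmul-involutive s _))
            (lmul-∼-if-same-block x-perm (proj₂ (x-perm (lo s))) (proj₂ (x-perm (hi s)))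
                                  (label-lo≡hi s valueBlock g s∉g (valueBlock-invariant u∼x s g sgu≡x)))

actW-snoc : ∀ {m} (ρ : List (Fin m)) s h → actW (ρ ++ s ∷ []) h ≡ actW ρ (Ts s h)
actW-snoc []      s h = refl
actW-snoc (i ∷ ρ) s h = cong (Ts i) (actW-snoc ρ s h)

module _ {m : ℕ} (J : Subset m) {x : Arr (suc m)} (x-perm : IsPerm x) (dec : ∀ u → Dec (u ∼[ J ] x)) (s : Fin m) where
  Ts-T-vanishes : ∀ {v} → lmul s v ≢ x → v ≢ x → ∀ k → Ts s (T x) v k ≡ ℤ.0ℤ
  Ts-T-vanishes {v} sv≢x v≢x k =
    cong₂ ℤ._+_ (T-off-diagonal k sv≢x)
                (trans (cong (when (descends (lmul s) v)) (δ-T-off-diagonal v≢x k)) (when-0 (descends (lmul s) v)))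

  P-Ts-T-on-orbit : ∀ {u} → u ∼[ J ] x → ∀ g → s ∉ g → Ts s (T x) (lmulW g u) ≗ P x J dec (Ts s (T x)) (lmulW g u)
  P-Ts-T-on-orbit {u} u∼x g s∉g k with dec (lmulW g u)
  ... | yes _   = refl
  ... | no v≁x = Ts-T-vanishes (v≁x ∘ sgu≡x⇒gu∼x J x-perm u∼x s g s∉g)
                               (λ v≡x → v≁x (subst (_∼[ J ] x) (sym v≡x) (∼-refl J x))) k

corollary3p3 : (m : ℕ) (J : Subset m) (x : Arr (suc m)) → IsPerm x →
    (dec : ∀ u → Dec (u ∼[ J ] x)) →
    (w' : Arr (suc m)) (s : Fin m) (ρ : List (Fin m)) → Reduced ρ w' → s ∉ ρ →
    (σ : List (Fin m)) → Reduced σ (rmul w' s) →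
    P x J dec (actW σ (T x)) ≋ P x J dec (actW ρ (P x J dec (Ts s (T x))))
corollary3p3 m J x x-perm dec w' s ρ ρ-reduced s∉ρ σ σ-reduced u k with dec u
... | no _    = refl
... | yes u∼x = begin
  actW σ (T x) u k                       ≡⟨ actW-reduced-T x-perm {σ} {ρ ++ s ∷ []} σ-reduced ρs-reduced u u-perm k ⟩
  actW (ρ ++ s ∷ []) (T x) u k           ≡⟨ cong (λ h → h u k) (actW-snoc ρ s (T x)) ⟩
  actW ρ (Ts s (T x)) u k                ≡⟨ actW-local s ρ s∉ρ u (P-Ts-T-on-orbit J x-perm dec s u∼x) k ⟩
  actW ρ (P x J dec (Ts s (T x))) u k    ∎
  where
  open ≡-Reasoning
  u-perm : IsPerm u
  u-perm = ∼⇒IsPerm J {u} {x} x-perm u∼x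
  ρs-reduced : Reduced (ρ ++ s ∷ []) (rmul w' s)
  ρs-reduced = Reduced-snoc s ρ-reduced s∉ρ
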